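{- Let $P_q(t)=\sum_{n\geq1}\dfrac{[p_n]_q}{[n]_q}t^n\in\Lambda_K[[t]]$. Then \[ H(t)=\mathbf{E}_q\big[P_q(t)\big]^{*}_q . \]
   Context: Let $q$ be an indeterminate, $K$ a field containing $\mathbb{Q}(q)$, $\Lambda_K$ the algebra of symmetric functions in $x_1,x_2,\dots$ over $K$, $e_n,h_n$ the elementary and complete homogeneous symmetric functions ($e_0=h_0=1$), $E(t)=\sum_{n\ge0}e_nt^n$, $H(t)=\sum_{n\ge0}h_nt^n$. $[n]_q=1+q+\cdots+q^{n-1}$ ($n\ge1$), $[0]_q=0$, $[n]_q!=[1]_q\cdots[n]_q$, $[0]_q!=1$. $D_qF(t)=\dfrac{F(qt)-F(t)}{(q-1)t}$. The $q$-power sums $[p_n]_q\in\Lambda_K$ are defined by $\sum_{n\geq1}[p_n]_q(-t)^{n-1}=D_qE(t)/E(t)$. The $q^*$-composition: for $A$ a commutative algebra over a field containing $\mathbb{Q}(q)$ and $F\in A[[t]]$ with $F(0)=0$, set $F^{[0]^*}=1$ and, for $k\geq1$, let $F^{[k]^*}$ be the unique series with zero constant term such that $D_qF^{[k]^*}(t)=[k]_q\,q^{ -(k-1)}\,F^{[k-1]^*}(qt)\,D_qF(t)$. For $G(t)=\sum_{k\ge0}g_kt^k/[k]_q!\in A[[t]]$, define $G[F]^*_q=\sum_{k\ge0}g_kF^{[k]^*}/[k]_q!$. Finally $\mathbf{E}_q(t)=\sum_{n\geq0}q^{\binom n2}t^n/[n]_q!$. -}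

module Defs where

open import Level using (Level; _⊔_) renaming (suc to lsuc)
open import Algebra.Bundles using (CommutativeRing)
open import Data.Bool using (Bool; true; false; if_then_else_; _∧_)
open import Data.Nat as ℕ using (ℕ; zero; suc; _∸_)
open import Data.Integer as ℤ using (ℤ; +_; -[1+_])
open import Data.List using (List; []; _∷_; map; foldr; upTo; concatMap; zipWith)
open import Data.Nat.ListAction using (sum)
open import Data.Bool.ListAction using (and)
open import Data.List.Relation.Unary.Any using (Any)
open import Data.Product using (_×_)
open import Relation.Binary.PropositionalEquality using (_≡_)
open import Relation.Nullary using (¬_)

module IntPoly {c ℓ : Level} (R : CommutativeRing c ℓ) where
  open CommutativeRing R

  natR : ℕ → Carrier
  natR zero = 0#
  natR (suc n) = 1# + natR n

  intR : ℤ → Carrier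
  intR (+ n) = natR n
  intR -[1+ n ] = - natR (suc n)

  evalPoly : List ℤ → Carrier → Carrier
  evalPoly [] x = 0#
  evalPoly (a ∷ as) x = intR a + x * evalPoly as x

-- A field K containing Q(q): a field (inverse given as a total function,
-- which is a genuine inverse on nonzero elements) together with an
-- element q transcendental over Q (no nonzero integer polynomial
-- vanishes at q; this also forces characteristic 0).  Such K contain
-- the subfield Q(q), and conversely.

record QqField (c ℓ : Level) : Set (lsuc (c ⊔ ℓ)) where
  field
    cring : CommutativeRing c ℓ
  open CommutativeRing cring public hiding (ring)
  open IntPoly cring public
  field
    _⁻¹       : Carrier → Carrier
    0≉1       : ¬ (0# ≈ 1#)
    ⁻¹-inverse : ∀ x → ¬ (x ≈ 0#) → (x * (x ⁻¹)) ≈ 1#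
    q         : Carrier
    q-transcendental : ∀ (cs : List ℤ) → Any (λ a → ¬ (a ≡ ℤ.0ℤ)) cs →
                       ¬ (evalPoly cs q ≈ 0#)

module Sym {c ℓ : Level} (K : QqField c ℓ) where
  open QqField K

  infixl 7 _·_ _▸_ _⊛_ _⊙_
  infixl 6 _⊕_ _⊞_
  infix 4 _≋_

  pow : Carrier → ℕ → Carrier
  pow x zero = 1#
  pow x (suc n) = x * pow x n

  ΣK : List Carrier → Carrier
  ΣK = foldr _+_ 0#

  qint : ℕ → Carrier
  qint zero = 0#
  qint (suc n) = 1# + q * qint n

  qfact : ℕ → Carrier
  qfact zero = 1#
  qfact (suc n) = qint (suc n) * qfact n

  binom2 : ℕ → ℕ
  binom2 n = (n ℕ.* (n ∸ 1)) ℕ./ 2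

  -- Monomials x_1^{a_1} x_2^{a_2} ... (finitely many variables listed)
  Mon : Set
  Mon = List ℕ

  -- Elements of K[[x_1,x_2,...]] by their coefficients; Λ_K is the
  -- subring of symmetric bounded-degree elements, which contains all
  -- the elements considered below.
  Λ : Set c
  Λ = Mon → Carrier

  boxes : Mon → List Mon
  boxes [] = [] ∷ []
  boxes (a ∷ α) = concatMap (λ b → map (b ∷_) (boxes α)) (upTo (suc a))

  _⊕_ : Λ → Λ → Λ
  (f ⊕ g) α = f α + g α

  _·_ : Λ → Λ → Λ
  (f · g) α = ΣK (map (λ β → f β * g (zipWith _∸_ α β)) (boxes α))

  _▸_ : Carrier → Λ → Λ
  (a ▸ f) α = a * f α

  0Λ : Λ
  0Λ α = 0#

  1Λ : Λ
  1Λ α = if sum α ℕ.≡ᵇ 0 then 1# else 0#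

  ΣΛ : List Λ → Λ
  ΣΛ = foldr _⊕_ 0Λ

  e : ℕ → Λ
  e n α = if and (map (λ a → a ℕ.≤ᵇ 1) α) ∧ (sum α ℕ.≡ᵇ n) then 1# else 0#

  h : ℕ → Λ
  h n α = if sum α ℕ.≡ᵇ n then 1# else 0#

  PS : Set c
  PS = ℕ → Λ

  _≋_ : PS → PS → Set ℓ
  F ≋ G = ∀ (n : ℕ) (α : Mon) → F n α ≈ G n α

  _⊞_ : PS → PS → PS
  (F ⊞ G) n = F n ⊕ G n

  _⊙_ : Carrier → PS → PS
  (a ⊙ F) n = a ▸ F n

  _⊛_ : PS → PS → PS
  (F ⊛ G) n = ΣΛ (map (λ k → F k · G (n ∸ k)) (upTo (suc n)))

  E H : PS
  E = e
  H = h

  atq : PS → PS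
  atq F n = pow q n ▸ F n

  -- D_q F(t) = (F(qt) - F(t)) / ((q-1) t): coefficient of t^n is
  -- (q^{n+1} - 1)/(q - 1) times the coefficient of t^{n+1} in F.
  Dq : PS → PS
  Dq F n = ((pow q (suc n) - 1#) * ((q - 1#) ⁻¹)) ▸ F (suc n)

  -- p : ℕ → Λ (index 0 unused) are the q-power sums [p_n]_q iff
  --   Σ_{n≥1} [p_n]_q (-t)^{n-1} = D_q E(t) / E(t),
  -- i.e. (since E(t) is invertible) iff (Σ [p_n]_q (-t)^{n-1}) · E(t) = D_q E(t).
  signedShift : (ℕ → Λ) → PS
  signedShift p m = pow (- 1#) m ▸ p (suc m)

  IsQPowerSums : (ℕ → Λ) → Set ℓ
  IsQPowerSums p = signedShift p ⊛ E ≋ Dq E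

  Pq : (ℕ → Λ) → PS
  Pq p zero = 0Λ
  Pq p (suc n) = (qint (suc n) ⁻¹) ▸ p (suc n)

  -- Fk is the family of q*-composition powers F^{[k]*} of F (F(0)=0):
  -- F^{[0]*} = 1 and, for k ≥ 1, F^{[k]*} is the (unique) series with
  -- zero constant term with
  --   D_q F^{[k]*}(t) = [k]_q q^{-(k-1)} F^{[k-1]*}(qt) D_q F(t).
  1PS : PS
  1PS zero = 1Λ
  1PS (suc n) = 0Λ

  IsQStarPowers : PS → (ℕ → PS) → Set ℓ
  IsQStarPowers F Fk =
      (Fk 0 ≋ 1PS)
    × (∀ (k : ℕ) → (∀ (α : Mon) → Fk (suc k) 0 α ≈ 0#)
                 × (Dq (Fk (suc k)) ≋
                     (qint (suc k) * (pow q k ⁻¹)) ⊙ (atq (Fk k) ⊛ Dq F)))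

  -- G[F]^*_q for G(t) = Σ g_k t^k/[k]_q!, given the q*-powers Fk of F:
  -- Σ_k g_k F^{[k]*}/[k]_q!.  Since F^{[k]*} has order ≥ k, the
  -- coefficient of t^n only involves k ≤ n (finite sum).
  qstarComp : (ℕ → Carrier) → (ℕ → PS) → PS
  qstarComp g Fk n =
    ΣΛ (map (λ k → (g k * (qfact k ⁻¹)) ▸ Fk k n) (upTo (suc n)))

  -- E_q(t) = Σ q^{binom n 2} t^n/[n]_q!, i.e. g_n = q^{binom n 2}
  gEq : ℕ → Carrier
  gEq n = pow q (binom2 n)

{-# OPTIONS --safe #-}

-- Put W = D_q P_q = Σ_{n≥0} [p_{n+1}]_q tⁿ.  Both H and E_q[P_q]^*_q have constant term 1
-- and solve the linear q-difference equation D_q X(t) = X(qt) W(t), whose solution is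
-- unique: it determines [n+1]_q times the coefficient of t^{n+1} from the lower ones, and
-- [n+1]_q ≠ 0 because q is transcendental.
-- For H, the q-Leibniz rule applied to H(t) E(-t) = 1 gives D_q H(t) · E(-qt) =
-- -H(t) · D_q[E(-t)], and the defining relation of the q-power sums rewrites
-- -D_q[E(-t)] as W(t) E(-t).  For E_q[P_q]^*_q = Σ_k a_k F^{[k]*} with
-- a_k = q^{k(k-1)/2}/[k]_q!, the recursion for F^{[k]*} gives
-- D_q F^{[k+1]*} = [k+1]_q q^{-k} F^{[k]*}(qt) W(t), and a_{k+1} [k+1]_q q^{-k} = a_k.

module Submission where

open import Defs
open import Level using (Level)
open import Algebra.Bundles using (CommutativeRing; CommutativeSemiring; CommutativeMonoid)
open import Relation.Binary.Bundles using (Setoid)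
import Relation.Binary.Reasoning.Setoid
open import Data.Product using (_,_; proj₁; proj₂)
open import Data.Nat as ℕ using (ℕ; zero; suc; _∸_; _≤_; _<_; z≤n; s≤s)
import Data.Nat.Properties as ℕ
import Data.Nat.DivMod as DivMod
open import Data.Nat.Divisibility using (divides)
open import Data.Nat.Induction using (<-rec)
open import Data.Fin using (Fin; toℕ)
import Data.Fin.Properties as Fin
import Data.Bool.Properties as Bool
open import Data.Bool using (if_then_else_)
open import Data.List using (List; []; _∷_; map; upTo; applyUpTo; concatMap; zipWith; _++_; replicate)
open import Data.List.Relation.Unary.Any using (here; there)
open import Data.Integer as ℤ using (-[1+_])
import Data.List.Properties as List
open import Function using (_∘_)
open import Relation.Binary.PropositionalEquality as ≡ using (_≡_)

module FiniteSums {c ℓ : Level} (R : CommutativeSemiring c ℓ) where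
  open CommutativeSemiring R
  open import Algebra.Properties.CommutativeMonoid.Sum +-commutativeMonoid
    using (sum; sum-cong-≋; sum-replicate-zero; sum-init-last)
  import Algebra.Properties.CommutativeMonoid.Sum +-commutativeMonoid as Sum
  open import Algebra.Properties.Semiring.Sum semiring using (*-distribˡ-sum)
  open import Relation.Binary.Reasoning.Setoid setoid

  ∑ : ℕ → (ℕ → Carrier) → Carrier
  ∑ n f = sum (λ (i : Fin n) → f (toℕ i))

  ∑-cong : ∀ n {f g : ℕ → Carrier} → (∀ i → i < n → f i ≈ g i) → ∑ n f ≈ ∑ n g
  ∑-cong n f≈g = sum-cong-≋ (λ i → f≈g (toℕ i) (Fin.toℕ<n i))

  ∑-zero : ∀ n {f : ℕ → Carrier} → (∀ i → i < n → f i ≈ 0#) → ∑ n f ≈ 0#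
  ∑-zero n f≈0 = trans (∑-cong n f≈0) (sum-replicate-zero n)

  ∑-suc : ∀ n (f : ℕ → Carrier) → f 0 ≈ 0# → ∑ (suc n) f ≈ ∑ n (f ∘ suc)
  ∑-suc n f f₀≈0 = trans (+-congʳ f₀≈0) (+-identityˡ _)

  ∑-distrib-+ : ∀ n (f g : ℕ → Carrier) → ∑ n (λ i → f i + g i) ≈ ∑ n f + ∑ n g
  ∑-distrib-+ n f g = Sum.∑-distrib-+ {n} (f ∘ toℕ) (g ∘ toℕ)

  *-distribˡ-∑ : ∀ n a (f : ℕ → Carrier) → a * ∑ n f ≈ ∑ n (λ i → a * f i)
  *-distribˡ-∑ n a f = *-distribˡ-sum {n} a (f ∘ toℕ)

  ∑-comm : ∀ m n (f : ℕ → ℕ → Carrier) →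
           ∑ m (λ i → ∑ n (λ j → f i j)) ≈ ∑ n (λ j → ∑ m (λ i → f i j))
  ∑-comm m n f = Sum.∑-comm {m} {n} (λ i j → f (toℕ i) (toℕ j))

  ∑-last : ∀ n (f : ℕ → Carrier) → ∑ (suc n) f ≈ ∑ n f + f n
  ∑-last n f = trans (sum-init-last {n} (f ∘ toℕ))
    (+-cong (sum-cong-≋ {n} (λ i → reflexive (≡.cong f (Fin.toℕ-inject₁ i))))
            (reflexive (≡.cong f (Fin.toℕ-fromℕ n))))

  ∑-reverse : ∀ n (f : ℕ → Carrier) → ∑ (suc n) f ≈ ∑ (suc n) (λ i → f (n ∸ i))
  ∑-reverse zero f = refl
  ∑-reverse (suc n) f = begin
    ∑ (suc (suc n)) f                        ≈⟨ ∑-last (suc n) f ⟩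
    ∑ (suc n) f + f (suc n)                  ≈⟨ +-comm _ _ ⟩
    f (suc n) + ∑ (suc n) f                  ≈⟨ +-congˡ (∑-reverse n f) ⟩
    f (suc n) + ∑ (suc n) (λ i → f (n ∸ i)) ∎

  ∑-extend : ∀ m k (f : ℕ → Carrier) → (∀ i → m ≤ i → f i ≈ 0#) → ∑ m f ≈ ∑ (m ℕ.+ k) f
  ∑-extend zero    k f f≈0 = sym (∑-zero k (λ i _ → f≈0 i z≤n))
  ∑-extend (suc m) k f f≈0 = +-congˡ (∑-extend m k (f ∘ suc) (λ i m≤i → f≈0 (suc i) (s≤s m≤i)))

  conv : ℕ → (ℕ → ℕ → Carrier) → Carrier
  conv n f = ∑ (suc n) (λ k → f k (n ∸ k))

  conv-cong : ∀ n {f g : ℕ → ℕ → Carrier} →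
              (∀ i j → i ℕ.+ j ≡ n → f i j ≈ g i j) → conv n f ≈ conv n g
  conv-cong n f≈g = ∑-cong (suc n) (λ k k<1+n → f≈g k (n ∸ k) (ℕ.m+[n∸m]≡n (ℕ.≤-pred k<1+n)))

  conv-suc : ∀ n (f : ℕ → ℕ → Carrier) → f 0 (suc n) ≈ 0# → conv (suc n) f ≈ conv n (λ i j → f (suc i) j)
  conv-suc n f = ∑-suc (suc n) (λ k → f k (suc n ∸ k))

  conv-comm : ∀ n (f : ℕ → ℕ → Carrier) → conv n f ≈ conv n (λ i j → f j i)
  conv-comm n f = trans (∑-reverse n (λ k → f k (n ∸ k)))
    (∑-cong (suc n) (λ i i≤n → reflexive (≡.cong (f (n ∸ i)) (ℕ.m∸[m∸n]≡n (ℕ.≤-pred i≤n)))))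

  conv-assoc : ∀ n (f : ℕ → ℕ → ℕ → Carrier) →
               conv n (λ i l → conv i (λ j k → f j k l)) ≈ conv n (λ j i → conv i (λ k l → f j k l))
  conv-assoc zero    f = refl
  conv-assoc (suc n) f = begin
    conv (suc n) (λ i l → conv i (λ j k → f j k l))
      -- split off j = 0; the i = 0 summand of the remaining double sum is empty
      ≈⟨ ∑-distrib-+ (suc (suc n)) (λ i → f 0 i (suc n ∸ i))
                     (λ i → ∑ i (λ j → f (suc j) (i ∸ suc j) (suc n ∸ i))) ⟩
    conv (suc n) (f 0) + (0# + conv n (λ i l → conv i (λ j k → f (suc j) k l)))
      ≈⟨ +-congˡ (+-identityˡ _) ⟩
    conv (suc n) (f 0) + conv n (λ i l → conv i (λ j k → f (suc j) k l))
      ≈⟨ +-congˡ (conv-assoc n (f ∘ suc)) ⟩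
    conv (suc n) (λ j i → conv i (λ k l → f j k l)) ∎

module PowerSeriesAlgebra {c ℓ : Level} (K : QqField c ℓ) where
  open QqField K
  open Sym K
  open FiniteSums commutativeSemiring public
  open import Relation.Binary.Reasoning.Setoid setoid

  infix 4 _≈Λ_
  _≈Λ_ : Λ → Λ → Set ℓ
  f ≈Λ g = ∀ α → f α ≈ g α

  ΣK-applyUpTo : ∀ n (f : ℕ → Carrier) (g : ℕ → ℕ) → ΣK (map f (applyUpTo g n)) ≡ ∑ n (f ∘ g)
  ΣK-applyUpTo zero    f g = ≡.refl
  ΣK-applyUpTo (suc n) f g = ≡.cong (f (g 0) +_) (ΣK-applyUpTo n f (g ∘ suc))

  ΣK-upTo : ∀ n (f : ℕ → Carrier) → ΣK (map f (upTo n)) ≡ ∑ n f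
  ΣK-upTo n f = ΣK-applyUpTo n f (λ i → i)

  ΣΛ-map : ∀ {A : Set} (F : A → Λ) xs α → ΣΛ (map F xs) α ≡ ΣK (map (λ x → F x α) xs)
  ΣΛ-map F []       α = ≡.refl
  ΣΛ-map F (x ∷ xs) α = ≡.cong (F x α +_) (ΣΛ-map F xs α)

  ΣK-map-cong : ∀ {A : Set} (xs : List A) {f g : A → Carrier} → (∀ x → f x ≈ g x) →
                ΣK (map f xs) ≈ ΣK (map g xs)
  ΣK-map-cong []       f≈g = refl
  ΣK-map-cong (x ∷ xs) f≈g = +-cong (f≈g x) (ΣK-map-cong xs f≈g)

  ΣK-map-zero : ∀ {A : Set} (xs : List A) {f : A → Carrier} → (∀ x → f x ≈ 0#) → ΣK (map f xs) ≈ 0#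
  ΣK-map-zero xs f≈0 = trans (ΣK-map-cong xs f≈0) (zero-sum xs)
    where
    zero-sum : ∀ {A : Set} (xs : List A) → ΣK (map (λ _ → 0#) xs) ≈ 0#
    zero-sum []       = refl
    zero-sum (x ∷ xs) = trans (+-identityˡ _) (zero-sum xs)

  ΣK-map-distrib-+ : ∀ {A : Set} (xs : List A) (f g : A → Carrier) →
                     ΣK (map (λ x → f x + g x) xs) ≈ ΣK (map f xs) + ΣK (map g xs)
  ΣK-map-distrib-+ []       f g = sym (+-identityʳ 0#)
  ΣK-map-distrib-+ (x ∷ xs) f g = trans (+-congˡ (ΣK-map-distrib-+ xs f g)) (+-interchange _ _ _ _)
    where open import Algebra.Properties.CommutativeSemigroup +-commutativeSemigroup
            using () renaming (interchange to +-interchange)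

  *-distribˡ-ΣK-map : ∀ {A : Set} (xs : List A) a (f : A → Carrier) →
                      a * ΣK (map f xs) ≈ ΣK (map (λ x → a * f x) xs)
  *-distribˡ-ΣK-map []       a f = zeroʳ a
  *-distribˡ-ΣK-map (x ∷ xs) a f = trans (distribˡ a _ _) (+-congˡ (*-distribˡ-ΣK-map xs a f))

  ΣK-++ : ∀ xs ys → ΣK (xs ++ ys) ≈ ΣK xs + ΣK ys
  ΣK-++ []       ys = sym (+-identityˡ _)
  ΣK-++ (x ∷ xs) ys = trans (+-congˡ (ΣK-++ xs ys)) (sym (+-assoc _ _ _))

  ΣK-map-concatMap : ∀ {A B : Set} (φ : B → Carrier) (k : A → List B) xs →
                     ΣK (map φ (concatMap k xs)) ≈ ΣK (map (λ x → ΣK (map φ (k x))) xs)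
  ΣK-map-concatMap φ k []       = refl
  ΣK-map-concatMap φ k (x ∷ xs) = begin
    ΣK (map φ (k x ++ concatMap k xs))               ≡⟨ ≡.cong ΣK (List.map-++ φ (k x) _) ⟩
    ΣK (map φ (k x) ++ map φ (concatMap k xs))       ≈⟨ ΣK-++ (map φ (k x)) _ ⟩
    ΣK (map φ (k x)) + ΣK (map φ (concatMap k xs))  ≈⟨ +-congˡ (ΣK-map-concatMap φ k xs) ⟩
    ΣK (map (λ x → ΣK (map φ (k x))) (x ∷ xs))      ∎

  ·-congˡ : ∀ {f f′ : Λ} (g : Λ) → f ≈Λ f′ → (f · g) ≈Λ (f′ · g)
  ·-congˡ g f≈f′ α = ΣK-map-cong (boxes α) (λ β → *-congʳ (f≈f′ β))

  ·-congʳ : ∀ (f : Λ) {g g′ : Λ} → g ≈Λ g′ → (f · g) ≈Λ (f · g′)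
  ·-congʳ f g≈g′ α = ΣK-map-cong (boxes α) (λ β → *-congˡ (g≈g′ _))

  ·-zeroˡ : ∀ {f : Λ} (g : Λ) → f ≈Λ 0Λ → (f · g) ≈Λ 0Λ
  ·-zeroˡ g f≈0 α = ΣK-map-zero (boxes α) (λ β → trans (*-congʳ (f≈0 β)) (zeroˡ _))

  ·-scaleˡ : ∀ a (f g : Λ) → ((a ▸ f) · g) ≈Λ (a ▸ (f · g))
  ·-scaleˡ a f g α = trans (ΣK-map-cong (boxes α) (λ β → *-assoc _ _ _)) (sym (*-distribˡ-ΣK-map (boxes α) a _))

  ·-sumˡ : ∀ n (F : ℕ → Λ) (g : Λ) →
           ((λ β → ∑ n (λ i → F i β)) · g) ≈Λ (λ α → ∑ n (λ i → (F i · g) α))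
  ·-sumˡ zero    F g = ·-zeroˡ g (λ _ → refl)
  ·-sumˡ (suc n) F g α = trans
    (trans (ΣK-map-cong (boxes α) (λ β → distribʳ _ _ _)) (ΣK-map-distrib-+ (boxes α) _ _))
    (+-congˡ (·-sumˡ n (F ∘ suc) g α))

  ⊛-coeff : ∀ (F G : PS) n α → (F ⊛ G) n α ≡ conv n (λ i j → (F i · G j) α)
  ⊛-coeff F G n α = ≡.trans (ΣΛ-map (λ k → F k · G (n ∸ k)) (upTo (suc n)) α)
                            (ΣK-upTo (suc n) (λ k → (F k · G (n ∸ k)) α))

  -- Splitting off the exponent of x₁ turns the product of Λ into a Cauchy product over Λ,
  -- so the laws of Λ follow by induction on the monomial, the ⊛-…-at lemmas being the step.
  tails : Λ → PS
  tails f i β = f (i ∷ β)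

  ·-cons : ∀ (f g : Λ) a α → (f · g) (a ∷ α) ≈ (tails f ⊛ tails g) a α
  ·-cons f g a α = begin
    (f · g) (a ∷ α)
      ≈⟨ ΣK-map-concatMap φ (λ b → map (b ∷_) (boxes α)) (upTo (suc a)) ⟩
    ΣK (map (λ b → ΣK (map φ (map (b ∷_) (boxes α)))) (upTo (suc a)))
      ≡⟨ ≡.cong ΣK (List.map-cong (λ b → ≡.cong ΣK (≡.sym (List.map-∘ (boxes α)))) (upTo (suc a))) ⟩
    ΣK (map (λ b → (tails f b · tails g (a ∸ b)) α) (upTo (suc a)))
      ≡⟨ ≡.trans (ΣK-upTo (suc a) _) (≡.sym (⊛-coeff (tails f) (tails g) a α)) ⟩
    (tails f ⊛ tails g) a α ∎
    where
    φ : Mon → Carrier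
    φ β = f β * g (zipWith _∸_ (a ∷ α) β)

  ⊛-local : ∀ {F F′ : PS} (G : PS) n → (∀ i → i ≤ n → F i ≈Λ F′ i) → (F ⊛ G) n ≈Λ (F′ ⊛ G) n
  ⊛-local {F} {F′} G n F≈F′ α = begin
    (F ⊛ G) n α
      ≡⟨ ⊛-coeff F G n α ⟩
    conv n (λ i j → (F i · G j) α)
      ≈⟨ ∑-cong (suc n) (λ i i<1+n → ·-congˡ (G (n ∸ i)) (F≈F′ i (ℕ.≤-pred i<1+n)) α) ⟩
    conv n (λ i j → (F′ i · G j) α)
      ≡⟨ ⊛-coeff F′ G n α ⟨
    (F′ ⊛ G) n α ∎

  ⊛-localʳ : ∀ (F : PS) {G G′ : PS} n → (∀ j → j ≤ n → G j ≈Λ G′ j) → (F ⊛ G) n ≈Λ (F ⊛ G′) n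
  ⊛-localʳ F {G} {G′} n G≈G′ α = begin
    (F ⊛ G) n α
      ≡⟨ ⊛-coeff F G n α ⟩
    conv n (λ i j → (F i · G j) α)
      ≈⟨ ∑-cong (suc n) (λ i _ → ·-congʳ (F i) (G≈G′ (n ∸ i) (ℕ.m∸n≤m n i)) α) ⟩
    conv n (λ i j → (F i · G′ j) α)
      ≡⟨ ⊛-coeff F G′ n α ⟨
    (F ⊛ G′) n α ∎

  ⊛-comm-at : ∀ α → (∀ f g → (f · g) α ≈ (g · f) α) → ∀ (F G : PS) n → (F ⊛ G) n α ≈ (G ⊛ F) n α
  ⊛-comm-at α ·-comm-α F G n = begin
    (F ⊛ G) n α                         ≡⟨ ⊛-coeff F G n α ⟩
    conv n (λ i j → (F i · G j) α)      ≈⟨ conv-cong n (λ i j _ → ·-comm-α (F i) (G j)) ⟩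
    conv n (λ i j → (G j · F i) α)      ≈⟨ conv-comm n (λ i j → (G j · F i) α) ⟩
    conv n (λ j i → (G j · F i) α)      ≡⟨ ⊛-coeff G F n α ⟨
    (G ⊛ F) n α                         ∎

  ·-comm : ∀ α (f g : Λ) → (f · g) α ≈ (g · f) α
  ·-comm []      f g = +-congʳ (*-comm _ _)
  ·-comm (a ∷ α) f g = begin
    (f · g) (a ∷ α)              ≈⟨ ·-cons f g a α ⟩
    (tails f ⊛ tails g) a α      ≈⟨ ⊛-comm-at α (·-comm α) (tails f) (tails g) a ⟩
    (tails g ⊛ tails f) a α      ≈⟨ ·-cons g f a α ⟨
    (g · f) (a ∷ α)              ∎

  ·-zeroʳ : ∀ (f : Λ) {g : Λ} → g ≈Λ 0Λ → (f · g) ≈Λ 0Λ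
  ·-zeroʳ f g≈0 α = trans (·-comm α f _) (·-zeroˡ f g≈0 α)

  ·-scaleʳ : ∀ a (f g : Λ) → (f · (a ▸ g)) ≈Λ (a ▸ (f · g))
  ·-scaleʳ a f g α = trans (·-comm α f _) (trans (·-scaleˡ a g f α) (*-congˡ (·-comm α g f)))

  ·-scale : ∀ a b (f g : Λ) → ((a ▸ f) · (b ▸ g)) ≈Λ ((a * b) ▸ (f · g))
  ·-scale a b f g α = begin
    ((a ▸ f) · (b ▸ g)) α     ≈⟨ ·-scaleˡ a f (b ▸ g) α ⟩
    a * (f · (b ▸ g)) α       ≈⟨ *-congˡ (·-scaleʳ b f g α) ⟩
    a * (b * (f · g) α)       ≈⟨ *-assoc a b _ ⟨
    (a * b) * (f · g) α       ∎

  ·-sumʳ : ∀ n (f : Λ) (G : ℕ → Λ) →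
           (f · (λ β → ∑ n (λ i → G i β))) ≈Λ (λ α → ∑ n (λ i → (f · G i) α))
  ·-sumʳ n f G α = trans (·-comm α f _) (trans (·-sumˡ n G f α) (∑-cong n (λ i _ → ·-comm α (G i) f)))

  ⊛-assoc-at : ∀ α → (∀ f g h → ((f · g) · h) α ≈ (f · (g · h)) α) →
               ∀ (F G H : PS) n → ((F ⊛ G) ⊛ H) n α ≈ (F ⊛ (G ⊛ H)) n α
  ⊛-assoc-at α ·-assoc-α F G H n = begin
    ((F ⊛ G) ⊛ H) n α
      ≡⟨ ⊛-coeff (F ⊛ G) H n α ⟩
    conv n (λ i l → ((F ⊛ G) i · H l) α)
      ≈⟨ conv-cong n (λ i l _ → ·-congˡ (H l) (λ β → reflexive (⊛-coeff F G i β)) α) ⟩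
    conv n (λ i l → ((λ β → conv i (λ j k → (F j · G k) β)) · H l) α)
      ≈⟨ conv-cong n (λ i l _ → ·-sumˡ (suc i) (λ j → F j · G (i ∸ j)) (H l) α) ⟩
    conv n (λ i l → conv i (λ j k → ((F j · G k) · H l) α))
      ≈⟨ conv-cong n (λ i l _ → conv-cong i (λ j k _ → ·-assoc-α (F j) (G k) (H l))) ⟩
    conv n (λ i l → conv i (λ j k → (F j · (G k · H l)) α))
      ≈⟨ conv-assoc n (λ j k l → (F j · (G k · H l)) α) ⟩
    conv n (λ j i → conv i (λ k l → (F j · (G k · H l)) α))
      ≈⟨ conv-cong n (λ j i _ → ·-sumʳ (suc i) (F j) (λ k → G k · H (i ∸ k)) α) ⟨
    conv n (λ j i → (F j · (λ β → conv i (λ k l → (G k · H l) β))) α)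
      ≈⟨ conv-cong n (λ j i _ → ·-congʳ (F j) (λ β → reflexive (⊛-coeff G H i β)) α) ⟨
    conv n (λ j i → (F j · (G ⊛ H) i) α)
      ≡⟨ ⊛-coeff F (G ⊛ H) n α ⟨
    (F ⊛ (G ⊛ H)) n α ∎

  ·-assoc : ∀ α (f g h : Λ) → ((f · g) · h) α ≈ (f · (g · h)) α
  ·-assoc []      f g h = +-congʳ (trans (*-congʳ (+-identityʳ _)) (trans (*-assoc _ _ _) (*-congˡ (sym (+-identityʳ _)))))
  ·-assoc (a ∷ α) f g h = begin
    ((f · g) · h) (a ∷ α)                    ≈⟨ ·-cons (f · g) h a α ⟩
    (tails (f · g) ⊛ tails h) a α            ≈⟨ ⊛-local (tails h) a (λ i _ → ·-cons f g i) α ⟩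
    ((tails f ⊛ tails g) ⊛ tails h) a α      ≈⟨ ⊛-assoc-at α (·-assoc α) (tails f) (tails g) (tails h) a ⟩
    (tails f ⊛ (tails g ⊛ tails h)) a α      ≈⟨ ⊛-localʳ (tails f) a (λ i _ → ·-cons g h i) α ⟨
    (tails f ⊛ tails (g · h)) a α            ≈⟨ ·-cons f (g · h) a α ⟨
    (f · (g · h)) (a ∷ α)                    ∎

  ⊛-identityˡ-at : ∀ α → (∀ f → (1Λ · f) α ≈ f α) → ∀ (F : PS) n → (1PS ⊛ F) n α ≈ F n α
  ⊛-identityˡ-at α ·-identityˡ-α F n = begin
    (1PS ⊛ F) n α
      ≡⟨ ⊛-coeff 1PS F n α ⟩
    (1Λ · F n) α + ∑ n (λ k → (0Λ · F (n ∸ suc k)) α)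
      ≈⟨ +-cong (·-identityˡ-α (F n)) (∑-zero n (λ k _ → ·-zeroˡ (F (n ∸ suc k)) (λ _ → refl) α)) ⟩
    F n α + 0#
      ≈⟨ +-identityʳ _ ⟩
    F n α ∎

  tails-1Λ : ∀ i → tails 1Λ i ≈Λ 1PS i
  tails-1Λ zero    β = refl
  tails-1Λ (suc i) β = refl

  ·-identityˡ : ∀ α (f : Λ) → (1Λ · f) α ≈ f α
  ·-identityˡ []      f = trans (+-identityʳ _) (*-identityˡ _)
  ·-identityˡ (a ∷ α) f = begin
    (1Λ · f) (a ∷ α)              ≈⟨ ·-cons 1Λ f a α ⟩
    (tails 1Λ ⊛ tails f) a α      ≈⟨ ⊛-local (tails f) a (λ i _ → tails-1Λ i) α ⟩
    (1PS ⊛ tails f) a α           ≈⟨ ⊛-identityˡ-at α (·-identityˡ α) (tails f) a ⟩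
    f (a ∷ α)                     ∎

  ≋-setoid : Setoid c ℓ
  ≋-setoid = record
    { Carrier       = PS
    ; _≈_           = _≋_
    ; isEquivalence = record
      { refl  = λ n α → refl
      ; sym   = λ F≋G n α → sym (F≋G n α)
      ; trans = λ F≋G G≋H n α → trans (F≋G n α) (G≋H n α)
      }
    }

  module ≈-Reasoning = Relation.Binary.Reasoning.Setoid setoid
  module ≋ = Setoid ≋-setoid
  module ≋-Reasoning = Relation.Binary.Reasoning.Setoid ≋-setoid

  ⊛-congˡ : ∀ {F F′ : PS} (G : PS) → F ≋ F′ → (F ⊛ G) ≋ (F′ ⊛ G)
  ⊛-congˡ G F≋F′ n = ⊛-local G n (λ i _ → F≋F′ i)

  ⊛-congʳ : ∀ (F : PS) {G G′ : PS} → G ≋ G′ → (F ⊛ G) ≋ (F ⊛ G′)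
  ⊛-congʳ F G≋G′ n = ⊛-localʳ F n (λ j _ → G≋G′ j)

  ⊛-comm : ∀ (F G : PS) → (F ⊛ G) ≋ (G ⊛ F)
  ⊛-comm F G n α = ⊛-comm-at α (·-comm α) F G n

  ⊛-assoc : ∀ (F G H : PS) → ((F ⊛ G) ⊛ H) ≋ (F ⊛ (G ⊛ H))
  ⊛-assoc F G H n α = ⊛-assoc-at α (·-assoc α) F G H n

  ⊛-identityˡ : ∀ (F : PS) → (1PS ⊛ F) ≋ F
  ⊛-identityˡ F n α = ⊛-identityˡ-at α (·-identityˡ α) F n

  ⊛-commutativeMonoid : CommutativeMonoid c ℓ
  ⊛-commutativeMonoid = record
    { Carrier             = PS
    ; _≈_                 = _≋_
    ; _∙_                 = _⊛_
    ; ε                   = 1PS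
    ; isCommutativeMonoid = record
      { isMonoid = record
        { isSemigroup = record
          { isMagma = record
            { isEquivalence = Setoid.isEquivalence ≋-setoid
            ; ∙-cong        = λ {F} {F′} {G} {G′} F≋F′ G≋G′ n α →
                                trans (⊛-congˡ G F≋F′ n α) (⊛-congʳ F′ G≋G′ n α)
            }
          ; assoc = ⊛-assoc
          }
        ; identity = ⊛-identityˡ , λ F n α → trans (⊛-comm F 1PS n α) (⊛-identityˡ F n α)
        }
      ; comm = ⊛-comm
      }
    }

  open CommutativeMonoid ⊛-commutativeMonoid public using () renaming (identityʳ to ⊛-identityʳ)
  open import Algebra.Properties.CommutativeSemigroup (CommutativeMonoid.commutativeSemigroup ⊛-commutativeMonoid)
    public using () renaming (x∙yz≈y∙xz to ⊛-lcomm)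

  ⊛-scaleˡ : ∀ r (F G : PS) → ((r ⊙ F) ⊛ G) ≋ (r ⊙ (F ⊛ G))
  ⊛-scaleˡ r F G n α = begin
    ((r ⊙ F) ⊛ G) n α                      ≡⟨ ⊛-coeff (r ⊙ F) G n α ⟩
    conv n (λ i j → ((r ▸ F i) · G j) α)   ≈⟨ conv-cong n (λ i j _ → ·-scaleˡ r (F i) (G j) α) ⟩
    conv n (λ i j → r * (F i · G j) α)     ≈⟨ *-distribˡ-∑ (suc n) r (λ k → (F k · G (n ∸ k)) α) ⟨
    r * conv n (λ i j → (F i · G j) α)     ≡⟨ ≡.cong (r *_) (⊛-coeff F G n α) ⟨
    (r ⊙ (F ⊛ G)) n α                      ∎

  ⊛-scaleʳ : ∀ r (F G : PS) → (F ⊛ (r ⊙ G)) ≋ (r ⊙ (F ⊛ G))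
  ⊛-scaleʳ r F G n α = trans (⊛-comm F (r ⊙ G) n α) (trans (⊛-scaleˡ r G F n α) (*-congˡ (⊛-comm G F n α)))

  ⊛-zeroʳ : ∀ (F : PS) {G : PS} → (∀ n → G n ≈Λ 0Λ) → ∀ n → (F ⊛ G) n ≈Λ 0Λ
  ⊛-zeroʳ F {G} G≈0 n α = trans (reflexive (⊛-coeff F G n α))
    (∑-zero (suc n) (λ k _ → ·-zeroʳ (F k) (G≈0 (n ∸ k)) α))

  ⊛-zeroˡ-upto : ∀ {F : PS} (G : PS) n → (∀ i → i ≤ n → F i ≈Λ 0Λ) → (F ⊛ G) n ≈Λ 0Λ
  ⊛-zeroˡ-upto {F} G n F≈0 α = trans (reflexive (⊛-coeff F G n α))
    (∑-zero (suc n) (λ k k<1+n → ·-zeroˡ (G (n ∸ k)) (F≈0 k (ℕ.≤-pred k<1+n)) α))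

  ∑PS : ℕ → (ℕ → PS) → PS
  ∑PS N X n α = ∑ N (λ j → X j n α)

  ⊛-sumˡ : ∀ N (X : ℕ → PS) (G : PS) → (∑PS N X ⊛ G) ≋ ∑PS N (λ j → X j ⊛ G)
  ⊛-sumˡ N X G n α = begin
    (∑PS N X ⊛ G) n α
      ≡⟨ ⊛-coeff (∑PS N X) G n α ⟩
    conv n (λ i l → (∑PS N X i · G l) α)
      ≈⟨ conv-cong n (λ i l _ → ·-sumˡ N (λ j → X j i) (G l) α) ⟩
    conv n (λ i l → ∑ N (λ j → (X j i · G l) α))
      ≈⟨ ∑-comm (suc n) N (λ k j → (X j k · G (n ∸ k)) α) ⟩
    ∑ N (λ j → conv n (λ i l → (X j i · G l) α))
      ≈⟨ ∑-cong N (λ j _ → reflexive (⊛-coeff (X j) G n α)) ⟨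
    ∑PS N (λ j → X j ⊛ G) n α ∎

  pow-+ : ∀ r m n → pow r (m ℕ.+ n) ≈ pow r m * pow r n
  pow-+ r zero    n = sym (*-identityˡ _)
  pow-+ r (suc m) n = trans (*-congˡ (pow-+ r m n)) (sym (*-assoc _ _ _))

  rescale : Carrier → PS → PS
  rescale r F n = pow r n ▸ F n

  rescale-cong : ∀ r {F G : PS} → F ≋ G → rescale r F ≋ rescale r G
  rescale-cong r F≋G n α = *-congˡ (F≋G n α)

  rescale-1PS : ∀ r → rescale r 1PS ≋ 1PS
  rescale-1PS r zero    α = *-identityˡ _
  rescale-1PS r (suc n) α = zeroʳ _

  rescale-⊛ : ∀ r (F G : PS) → rescale r (F ⊛ G) ≋ (rescale r F ⊛ rescale r G)
  rescale-⊛ r F G n α = begin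
    pow r n * (F ⊛ G) n α
      ≡⟨ ≡.cong (pow r n *_) (⊛-coeff F G n α) ⟩
    pow r n * conv n (λ i j → (F i · G j) α)
      ≈⟨ *-distribˡ-∑ (suc n) (pow r n) (λ k → (F k · G (n ∸ k)) α) ⟩
    conv n (λ i j → pow r n * (F i · G j) α)
      ≈⟨ conv-cong n split ⟩
    conv n (λ i j → (rescale r F i · rescale r G j) α)
      ≡⟨ ⊛-coeff (rescale r F) (rescale r G) n α ⟨
    (rescale r F ⊛ rescale r G) n α ∎
    where
    split : ∀ i j → i ℕ.+ j ≡ n → pow r n * (F i · G j) α ≈ (rescale r F i · rescale r G j) α
    split i j ≡.refl = trans (*-congʳ (pow-+ r i j)) (sym (·-scale (pow r i) (pow r j) (F i) (G j) α))

  shift : PS → PS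
  shift F zero    = 0Λ
  shift F (suc n) = F n

  shift-cong : ∀ {F G : PS} → F ≋ G → shift F ≋ shift G
  shift-cong F≋G zero    α = refl
  shift-cong F≋G (suc n) α = F≋G n α

  shift-⊛ : ∀ (F G : PS) → (shift F ⊛ G) ≋ shift (F ⊛ G)
  shift-⊛ F G zero    α = trans (+-identityʳ _) (·-zeroˡ {0Λ} (G 0) (λ _ → refl) α)
  shift-⊛ F G (suc n) α = begin
    (shift F ⊛ G) (suc n) α                             ≡⟨ ⊛-coeff (shift F) G (suc n) α ⟩
    (0Λ · G (suc n)) α + conv n (λ i j → (F i · G j) α) ≈⟨ +-congʳ (·-zeroˡ (G (suc n)) (λ _ → refl) α) ⟩
    0# + conv n (λ i j → (F i · G j) α)                 ≈⟨ +-identityˡ _ ⟩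
    conv n (λ i j → (F i · G j) α)                      ≡⟨ ⊛-coeff F G n α ⟨
    (F ⊛ G) n α                                         ∎

  ⊛-shift : ∀ (F G : PS) → (F ⊛ shift G) ≋ shift (F ⊛ G)
  ⊛-shift F G n α = trans (⊛-comm F (shift G) n α) (trans (shift-⊛ G F n α) (shift-cong (⊛-comm G F) n α))

  slice : ℕ → PS → PS
  slice b F n β = F n (b ∷ β)

  ⊛-slice : ∀ (F G : PS) a n α → (F ⊛ G) n (a ∷ α) ≈ conv a (λ b d → (slice b F ⊛ slice d G) n α)
  ⊛-slice F G a n α = begin
    (F ⊛ G) n (a ∷ α)
      ≡⟨ ⊛-coeff F G n (a ∷ α) ⟩
    conv n (λ i j → (F i · G j) (a ∷ α))
      ≈⟨ conv-cong n (λ i j _ → trans (·-cons (F i) (G j) a α)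
                                      (reflexive (⊛-coeff (tails (F i)) (tails (G j)) a α))) ⟩
    conv n (λ i j → conv a (λ b d → (slice b F i · slice d G j) α))
      ≈⟨ ∑-comm (suc n) (suc a) (λ k b → (slice b F k · slice (a ∸ b) G (n ∸ k)) α) ⟩
    conv a (λ b d → conv n (λ i j → (slice b F i · slice d G j) α))
      ≈⟨ conv-cong a (λ b d _ → reflexive (⊛-coeff (slice b F) (slice d G) n α)) ⟨
    conv a (λ b d → (slice b F ⊛ slice d G) n α) ∎

module QCalculus {c ℓ : Level} (K : QqField c ℓ) where
  open QqField K
  open Sym K
  open PowerSeriesAlgebra K
  open import Relation.Binary.Reasoning.Setoid setoid
  open import Algebra.Properties.CommutativeSemigroup *-commutativeSemigroup
    using () renaming (x∙yz≈y∙xz to *-lcomm; interchange to *-interchange)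

  *-cancelˡ : ∀ a {x y} → a ≉ 0# → a * x ≈ a * y → x ≈ y
  *-cancelˡ a {x} {y} a≉0 ax≈ay = begin
    x                    ≈⟨ *-identityˡ x ⟨
    1# * x               ≈⟨ *-congʳ (trans (*-comm _ _) (⁻¹-inverse a a≉0)) ⟨
    ((a ⁻¹) * a) * x     ≈⟨ *-assoc _ _ _ ⟩
    (a ⁻¹) * (a * x)     ≈⟨ *-congˡ ax≈ay ⟩
    (a ⁻¹) * (a * y)     ≈⟨ *-assoc _ _ _ ⟨
    ((a ⁻¹) * a) * y     ≈⟨ *-congʳ (trans (*-comm _ _) (⁻¹-inverse a a≉0)) ⟩
    1# * y               ≈⟨ *-identityˡ y ⟩
    y                    ∎

  *-≉0 : ∀ {x y} → x ≉ 0# → y ≉ 0# → x * y ≉ 0#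
  *-≉0 {x} x≉0 y≉0 xy≈0 = y≉0 (*-cancelˡ x x≉0 (trans xy≈0 (sym (zeroʳ x))))

  ⁻¹-distrib-* : ∀ {x y} → x ≉ 0# → y ≉ 0# → (x * y) ⁻¹ ≈ (x ⁻¹) * (y ⁻¹)
  ⁻¹-distrib-* {x} {y} x≉0 y≉0 = *-cancelˡ (x * y) (*-≉0 x≉0 y≉0) (begin
    (x * y) * ((x * y) ⁻¹)            ≈⟨ ⁻¹-inverse (x * y) (*-≉0 x≉0 y≉0) ⟩
    1#                                ≈⟨ *-identityˡ 1# ⟨
    1# * 1#                           ≈⟨ *-cong (⁻¹-inverse x x≉0) (⁻¹-inverse y y≉0) ⟨
    (x * (x ⁻¹)) * (y * (y ⁻¹))       ≈⟨ *-interchange _ _ _ _ ⟩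
    (x * y) * ((x ⁻¹) * (y ⁻¹))       ∎)

  evalPoly-ones : ∀ n → evalPoly (replicate n (ℤ.+ 1)) q ≈ qint n
  evalPoly-ones zero    = refl
  evalPoly-ones (suc n) = +-cong (+-identityʳ 1#) (*-congˡ (evalPoly-ones n))

  evalPoly-linear : ∀ a b → evalPoly (a ∷ b ∷ []) q ≈ intR a + q * intR b
  evalPoly-linear a b = +-congˡ (*-congˡ (trans (+-congˡ (zeroʳ q)) (+-identityʳ _)))

  qint-suc≉0 : ∀ n → qint (suc n) ≉ 0#
  qint-suc≉0 n = q-transcendental (replicate (suc n) (ℤ.+ 1)) (here (λ ())) ∘ trans (evalPoly-ones (suc n))

  q≉0 : q ≉ 0#
  q≉0 q≈0 = q-transcendental (ℤ.+ 0 ∷ ℤ.+ 1 ∷ []) (there (here (λ ()))) (begin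
    evalPoly (ℤ.+ 0 ∷ ℤ.+ 1 ∷ []) q   ≈⟨ evalPoly-linear (ℤ.+ 0) (ℤ.+ 1) ⟩
    0# + q * (1# + 0#)            ≈⟨ +-identityˡ _ ⟩
    q * (1# + 0#)                 ≈⟨ trans (*-congˡ (+-identityʳ 1#)) (*-identityʳ q) ⟩
    q                             ≈⟨ q≈0 ⟩
    0#                            ∎)

  q-1≉0 : q - 1# ≉ 0#
  q-1≉0 q-1≈0 = q-transcendental (-[1+ 0 ] ∷ ℤ.+ 1 ∷ []) (here (λ ())) (begin
    evalPoly (-[1+ 0 ] ∷ ℤ.+ 1 ∷ []) q   ≈⟨ evalPoly-linear -[1+ 0 ] (ℤ.+ 1) ⟩
    - (1# + 0#) + q * (1# + 0#)        ≈⟨ +-cong (-‿cong (+-identityʳ 1#))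
                                                  (trans (*-congˡ (+-identityʳ 1#)) (*-identityʳ q)) ⟩
    - 1# + q                           ≈⟨ +-comm _ _ ⟩
    q - 1#                             ≈⟨ q-1≈0 ⟩
    0#                                 ∎)

  pow-q≉0 : ∀ n → pow q n ≉ 0#
  pow-q≉0 zero    = 0≉1 ∘ sym
  pow-q≉0 (suc n) = *-≉0 q≉0 (pow-q≉0 n)

  qfact≉0 : ∀ n → qfact n ≉ 0#
  qfact≉0 zero    = 0≉1 ∘ sym
  qfact≉0 (suc n) = *-≉0 (qint-suc≉0 n) (qfact≉0 n)

  qint-geometric : ∀ n → (q - 1#) * qint n + 1# ≈ pow q n
  qint-geometric zero    = trans (+-congʳ (zeroʳ _)) (+-identityˡ 1#)
  qint-geometric (suc n) = begin
    (q - 1#) * (1# + q * qint n) + 1#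
      ≈⟨ +-congʳ (trans (distribˡ _ _ _) (+-cong (*-identityʳ _) (*-lcomm _ _ _))) ⟩
    ((q - 1#) + q * ((q - 1#) * qint n)) + 1#
      ≈⟨ trans (+-congʳ (+-comm _ _)) (+-assoc _ _ _) ⟩
    q * ((q - 1#) * qint n) + ((q - 1#) + 1#)
      ≈⟨ +-congˡ (trans (+-assoc _ _ _) (trans (+-congˡ (-‿inverseˡ 1#)) (+-identityʳ q))) ⟩
    q * ((q - 1#) * qint n) + q
      ≈⟨ trans (distribˡ _ _ _) (+-congˡ (*-identityʳ q)) ⟨
    q * ((q - 1#) * qint n + 1#)
      ≈⟨ *-congˡ (qint-geometric n) ⟩
    q * pow q n ∎

  Dq-factor : ∀ n → (pow q (suc n) - 1#) * ((q - 1#) ⁻¹) ≈ qint (suc n)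
  Dq-factor n = begin
    (pow q (suc n) - 1#) * ((q - 1#) ⁻¹)
      ≈⟨ *-congʳ (+-congʳ (qint-geometric (suc n))) ⟨
    (((q - 1#) * qint (suc n) + 1#) - 1#) * ((q - 1#) ⁻¹)
      ≈⟨ *-congʳ (trans (+-assoc _ _ _) (trans (+-congˡ (-‿inverseʳ 1#)) (+-identityʳ _))) ⟩
    ((q - 1#) * qint (suc n)) * ((q - 1#) ⁻¹)
      ≈⟨ trans (*-congʳ (*-comm _ _)) (*-assoc _ _ _) ⟩
    qint (suc n) * ((q - 1#) * ((q - 1#) ⁻¹))
      ≈⟨ trans (*-congˡ (⁻¹-inverse _ q-1≉0)) (*-identityʳ _) ⟩
    qint (suc n) ∎

  D : PS → PS
  D F n = qint (suc n) ▸ F (suc n)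

  Dq≋D : ∀ (F : PS) → Dq F ≋ D F
  Dq≋D F n α = *-congʳ (Dq-factor n)

  D-cong : ∀ {F G : PS} → F ≋ G → D F ≋ D G
  D-cong F≋G n α = *-congˡ (F≋G (suc n) α)

  D-1PS : ∀ n → D 1PS n ≈Λ 0Λ
  D-1PS n α = zeroʳ _

  D-rescale : ∀ r (F : PS) → D (rescale r F) ≋ (r ⊙ rescale r (D F))
  D-rescale r F n α = trans (*-congˡ (*-assoc _ _ _)) (trans (*-lcomm _ _ _) (*-congˡ (*-lcomm _ _ _)))

  qint-+ : ∀ i j → qint (i ℕ.+ j) ≈ qint i + pow q i * qint j
  qint-+ zero    j = sym (trans (+-identityˡ _) (*-identityˡ _))
  qint-+ (suc i) j = begin
    1# + q * qint (i ℕ.+ j)                   ≈⟨ +-congˡ (*-congˡ (qint-+ i j)) ⟩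
    1# + q * (qint i + pow q i * qint j)      ≈⟨ +-congˡ (distribˡ _ _ _) ⟩
    1# + (q * qint i + q * (pow q i * qint j)) ≈⟨ +-assoc _ _ _ ⟨
    (1# + q * qint i) + q * (pow q i * qint j) ≈⟨ +-congˡ (*-assoc _ _ _) ⟨
    qint (suc i) + pow q (suc i) * qint j     ∎

  D-⊛ : ∀ (F G : PS) → D (F ⊛ G) ≋ ((D F ⊛ rescale q G) ⊞ (F ⊛ D G))
  D-⊛ F G n α = begin
    qint (suc n) * (F ⊛ G) (suc n) α
      ≡⟨ ≡.cong (qint (suc n) *_) (⊛-coeff F G (suc n) α) ⟩
    qint (suc n) * conv (suc n) φ
      ≈⟨ *-distribˡ-∑ (suc (suc n)) (qint (suc n)) (λ k → φ k (suc n ∸ k)) ⟩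
    conv (suc n) (λ i j → qint (suc n) * φ i j)
      ≈⟨ conv-cong (suc n) split ⟩
    conv (suc n) (λ i j → (pow q j * qint i) * φ i j + qint j * φ i j)
      ≈⟨ ∑-distrib-+ (suc (suc n)) (λ k → (pow q (suc n ∸ k) * qint k) * φ k (suc n ∸ k))
                                   (λ k → qint (suc n ∸ k) * φ k (suc n ∸ k)) ⟩
    conv (suc n) (λ i j → (pow q j * qint i) * φ i j) + conv (suc n) (λ i j → qint j * φ i j)
      ≈⟨ +-cong moving-F moving-G ⟩
    (D F ⊛ rescale q G) n α + (F ⊛ D G) n α
      ∎
    where
    φ : ℕ → ℕ → Carrier
    φ i j = (F i · G j) α

    split : ∀ i j → i ℕ.+ j ≡ suc n → qint (suc n) * φ i j ≈ (pow q j * qint i) * φ i j + qint j * φ i j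
    split i j i+j≡1+n = begin
      qint (suc n) * φ i j
        ≡⟨ ≡.cong (λ m → qint m * φ i j) (≡.trans (≡.sym i+j≡1+n) (ℕ.+-comm i j)) ⟩
      qint (j ℕ.+ i) * φ i j
        ≈⟨ trans (*-congʳ (qint-+ j i)) (distribʳ _ _ _) ⟩
      qint j * φ i j + (pow q j * qint i) * φ i j
        ≈⟨ +-comm _ _ ⟩
      (pow q j * qint i) * φ i j + qint j * φ i j ∎

    moving-F : conv (suc n) (λ i j → (pow q j * qint i) * φ i j) ≈ (D F ⊛ rescale q G) n α
    moving-F = begin
      conv (suc n) (λ i j → (pow q j * qint i) * φ i j)
        ≈⟨ conv-suc n (λ i j → (pow q j * qint i) * φ i j) (trans (*-congʳ (zeroʳ _)) (zeroˡ _)) ⟩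
      conv n (λ i j → (pow q j * qint (suc i)) * φ (suc i) j)
        ≈⟨ conv-cong n (λ i j _ → trans (*-congʳ (*-comm _ _))
                                        (sym (·-scale (qint (suc i)) (pow q j) (F (suc i)) (G j) α))) ⟩
      conv n (λ i j → (D F i · rescale q G j) α)
        ≡⟨ ⊛-coeff (D F) (rescale q G) n α ⟨
      (D F ⊛ rescale q G) n α
        ∎

    moving-G : conv (suc n) (λ i j → qint j * φ i j) ≈ (F ⊛ D G) n α
    moving-G = begin
      conv (suc n) (λ i j → qint j * φ i j)
        ≈⟨ conv-comm (suc n) (λ i j → qint j * φ i j) ⟩
      conv (suc n) (λ j i → qint j * φ i j)
        ≈⟨ conv-suc n (λ j i → qint j * φ i j) (zeroˡ _) ⟩
      conv n (λ j i → qint (suc j) * φ i (suc j))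
        ≈⟨ conv-cong n (λ j i _ → sym (·-scaleʳ (qint (suc j)) (F i) (G (suc j)) α)) ⟩
      conv n (λ j i → (F i · D G j) α)
        ≈⟨ conv-comm n (λ i j → (F i · D G j) α) ⟨
      conv n (λ i j → (F i · D G j) α)
        ≡⟨ ⊛-coeff F (D G) n α ⟨
      (F ⊛ D G) n α
        ∎

module CompleteTimesElementary {c ℓ : Level} (K : QqField c ℓ) where
  open QqField K
  open Sym K
  open PowerSeriesAlgebra K
  open import Relation.Binary.Reasoning.Setoid setoid
  open import Algebra.Properties.Ring (CommutativeRing.ring cring) using (-1*x≈-x)

  Ē : PS
  Ē = rescale (- 1#) E

  slice-H-suc : ∀ a → slice (suc a) H ≋ shift (slice a H)
  slice-H-suc a zero    β = refl
  slice-H-suc a (suc n) β = refl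

  slice-Ē-1 : slice 1 Ē ≋ ((- 1#) ⊙ shift Ē)
  slice-Ē-1 zero    β = trans (*-identityˡ _)
    (trans (reflexive (≡.cong (λ b → if b then 1# else 0#) (Bool.∧-zeroʳ _))) (sym (zeroʳ _)))
  slice-Ē-1 (suc n) β = *-assoc _ _ _

  slice-Ē-2+ : ∀ k n → slice (2 ℕ.+ k) Ē n ≈Λ 0Λ
  slice-Ē-2+ k n β = zeroʳ _

  slice-1PS-zero : ∀ n → slice 0 1PS n ≈Λ 1PS n
  slice-1PS-zero zero    β = refl
  slice-1PS-zero (suc n) β = refl

  slice-1PS-suc : ∀ a n → slice (suc a) 1PS n ≈Λ 0Λ
  slice-1PS-suc a zero    β = refl
  slice-1PS-suc a (suc n) β = refl

  H⊛Ē-constant : ∀ n → (H ⊛ Ē) n [] ≈ 1PS n []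
  H⊛Ē-constant zero    = trans (reflexive (⊛-coeff H Ē 0 []))
    (trans (+-identityʳ _) (trans (+-identityʳ _) (trans (*-identityˡ _) (*-identityˡ _))))
  H⊛Ē-constant (suc m) = trans (reflexive (⊛-coeff H Ē (suc m) [])) (∑-zero (suc (suc m)) term≈0)
    where
    term≈0 : ∀ k → k < suc (suc m) → (h k · Ē (suc m ∸ k)) [] ≈ 0#
    term≈0 zero    _ = trans (+-identityʳ _) (trans (*-identityˡ _) (zeroʳ _))
    term≈0 (suc k) _ = trans (+-identityʳ _) (zeroˡ _)

  -- Induction on the monomial via ⊛-slice: in x₁, H(t) = Σ_b (x₁t)^b H′(t) and
  -- E(-t) = (1 - x₁t) E′(-t).
  H⊛Ē≈1PS : ∀ α n → (H ⊛ Ē) n α ≈ 1PS n α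
  H⊛Ē≈1PS []          n = H⊛Ē-constant n
  H⊛Ē≈1PS (zero ∷ α)  n = begin
    (H ⊛ Ē) n (0 ∷ α)                  ≈⟨ ⊛-slice H Ē 0 n α ⟩
    (slice 0 H ⊛ slice 0 Ē) n α + 0#   ≈⟨ +-identityʳ _ ⟩
    (H ⊛ Ē) n α                        ≈⟨ H⊛Ē≈1PS α n ⟩
    1PS n α                            ≈⟨ slice-1PS-zero n α ⟨
    1PS n (0 ∷ α)                      ∎
  H⊛Ē≈1PS (suc a ∷ α) n = begin
    (H ⊛ Ē) n (suc a ∷ α)
      ≈⟨ ⊛-slice H Ē (suc a) n α ⟩
    conv (suc a) X
      ≈⟨ conv-comm (suc a) X ⟩
    -- the reversed sum unfolds definitionally into the summands d = 0, d = 1 and d ≥ 2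
    X (suc a) 0 + (X a 1 + ∑ a (λ k → X (a ∸ suc k) (2 ℕ.+ k)))
      ≈⟨ +-congˡ (trans (+-congˡ (∑-zero a (λ k _ → ⊛-zeroʳ (slice (a ∸ suc k) H) (slice-Ē-2+ k) n α)))
                        (+-identityʳ _)) ⟩
    X (suc a) 0 + X a 1
      ≈⟨ +-cong slice-0-term slice-1-term ⟩
    Y + (- 1#) * Y
      ≈⟨ trans (+-congˡ (-1*x≈-x Y)) (-‿inverseʳ Y) ⟩
    0#
      ≈⟨ slice-1PS-suc a n α ⟨
    1PS n (suc a ∷ α)
      ∎
    where
    X : ℕ → ℕ → Carrier
    X b d = (slice b H ⊛ slice d Ē) n α

    Y : Carrier
    Y = shift (slice a H ⊛ Ē) n α

    slice-0-term : X (suc a) 0 ≈ Y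
    slice-0-term = trans (⊛-congˡ Ē (slice-H-suc a) n α) (shift-⊛ (slice a H) Ē n α)

    slice-1-term : X a 1 ≈ (- 1#) * Y
    slice-1-term = begin
      (slice a H ⊛ slice 1 Ē) n α              ≈⟨ ⊛-congʳ (slice a H) slice-Ē-1 n α ⟩
      (slice a H ⊛ ((- 1#) ⊙ shift Ē)) n α     ≈⟨ ⊛-scaleʳ (- 1#) (slice a H) (shift Ē) n α ⟩
      (- 1#) * (slice a H ⊛ shift Ē) n α       ≈⟨ *-congˡ (⊛-shift (slice a H) Ē n α) ⟩
      (- 1#) * Y                               ∎

  H⊛Ē≋1PS : (H ⊛ Ē) ≋ 1PS
  H⊛Ē≋1PS n α = H⊛Ē≈1PS α n

module QExponentialEquation {c ℓ : Level} (K : QqField c ℓ) where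
  open QqField K
  open Sym K
  open PowerSeriesAlgebra K
  open QCalculus K
  open import Relation.Binary.Reasoning.Setoid setoid
  open import Algebra.Properties.CommutativeSemigroup *-commutativeSemigroup using () renaming (x∙yz≈y∙xz to *-lcomm)
  open import Algebra.Solver.CommutativeMonoid *-commutativeMonoid
    using (solve; _⊜_) renaming (_⊕_ to _⊗_)

  SolvesQExp : PS → PS → Set ℓ
  SolvesQExp W X = D X ≋ (rescale q X ⊛ W)

  SolvesQExp-unique : ∀ W {X Y} → X 0 ≈Λ Y 0 → SolvesQExp W X → SolvesQExp W Y → X ≋ Y
  SolvesQExp-unique W {X} {Y} X₀≈Y₀ solX solY = <-rec (λ n → X n ≈Λ Y n) agree
    where
    agree : ∀ n → (∀ {m} → m < n → X m ≈Λ Y m) → X n ≈Λ Y n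
    agree zero    _  = X₀≈Y₀
    agree (suc n) ih α = *-cancelˡ (qint (suc n)) (qint-suc≉0 n) (begin
      qint (suc n) * X (suc n) α   ≈⟨ solX n α ⟩
      (rescale q X ⊛ W) n α        ≈⟨ ⊛-local W n (λ i i≤n β → *-congˡ (ih (s≤s i≤n) β)) α ⟩
      (rescale q Y ⊛ W) n α        ≈⟨ solY n α ⟨
      qint (suc n) * Y (suc n) α   ∎)

  binom2-suc : ∀ k → binom2 (suc k) ≡ binom2 k ℕ.+ k
  binom2-suc zero    = ≡.refl
  binom2-suc (suc k) = ≡.trans (≡.cong (ℕ._/ 2) product-split)
    (≡.trans (DivMod.+-distrib-/-∣ʳ (suc k ℕ.* k) (divides (suc k) ≡.refl))
             (≡.cong (binom2 (suc k) ℕ.+_) (DivMod.m*n/n≡m (suc k) 2)))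
    where
    product-split : suc (suc k) ℕ.* suc k ≡ suc k ℕ.* k ℕ.+ suc k ℕ.* 2
    product-split = ≡.trans (ℕ.*-comm (2 ℕ.+ k) (suc k))
      (≡.trans (≡.cong (suc k ℕ.*_) (ℕ.+-comm 2 k)) (ℕ.*-distribˡ-+ (suc k) k 2))

  Eq-coefficient : ℕ → Carrier
  Eq-coefficient k = gEq k * (qfact k ⁻¹)

  Eq-coefficient-step : ∀ k → Eq-coefficient (suc k) * (qint (suc k) * (pow q k ⁻¹)) ≈ Eq-coefficient k
  Eq-coefficient-step k = begin
    (pow q (binom2 (suc k)) * ((I * k!) ⁻¹)) * (I * (Q ⁻¹))
      ≈⟨ *-congʳ (*-cong (trans (reflexive (≡.cong (pow q) (binom2-suc k))) (pow-+ q (binom2 k) k))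
                          (⁻¹-distrib-* (qint-suc≉0 k) (qfact≉0 k))) ⟩
    ((B * Q) * ((I ⁻¹) * (k! ⁻¹))) * (I * (Q ⁻¹))
      ≈⟨ rearrange B Q (I ⁻¹) (k! ⁻¹) I (Q ⁻¹) ⟩
    (B * (k! ⁻¹)) * ((Q * (Q ⁻¹)) * ((I ⁻¹) * I))
      ≈⟨ *-congˡ (*-cong (⁻¹-inverse Q (pow-q≉0 k)) (trans (*-comm _ _) (⁻¹-inverse I (qint-suc≉0 k)))) ⟩
    (B * (k! ⁻¹)) * (1# * 1#)
      ≈⟨ trans (*-congˡ (*-identityˡ 1#)) (*-identityʳ _) ⟩
    Eq-coefficient k
      ∎
    where
    I k! B Q : Carrier
    I = qint (suc k)
    k! = qfact k
    B = pow q (binom2 k)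
    Q = pow q k
    rearrange : ∀ b x y z u v → ((b * x) * (y * z)) * (u * v) ≈ (b * z) * ((x * v) * (y * u))
    rearrange = solve 6 (λ b x y z u v → ((b ⊗ x) ⊗ (y ⊗ z)) ⊗ (u ⊗ v) ⊜ (b ⊗ z) ⊗ ((x ⊗ v) ⊗ (y ⊗ u)))
                        refl

  module QStarPowers (F : PS) (Fk : ℕ → PS) (powers : IsQStarPowers F Fk) where
    Fk-D : ∀ k → D (Fk (suc k)) ≋ ((qint (suc k) * (pow q k ⁻¹)) ⊙ (rescale q (Fk k) ⊛ Dq F))
    Fk-D k n α = trans (sym (Dq≋D (Fk (suc k)) n α)) (proj₂ (proj₂ powers k) n α)

    Fk-order : ∀ k i → i < k → Fk k i ≈Λ 0Λ
    Fk-order (suc k) zero    _         = proj₁ (proj₂ powers k)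
    Fk-order (suc k) (suc m) (s≤s m<k) α = *-cancelˡ (qint (suc m)) (qint-suc≉0 m) (begin
      qint (suc m) * Fk (suc k) (suc m) α                         ≈⟨ Fk-D k m α ⟩
      (qint (suc k) * (pow q k ⁻¹)) * (rescale q (Fk k) ⊛ Dq F) m α
        ≈⟨ *-congˡ (⊛-zeroˡ-upto (Dq F) m
                      (λ i i≤m β → trans (*-congˡ (Fk-order k i (ℕ.≤-<-trans i≤m m<k) β)) (zeroʳ _)) α) ⟩
      (qint (suc k) * (pow q k ⁻¹)) * 0#                          ≈⟨ zeroʳ _ ⟩
      0#                                                          ≈⟨ zeroʳ _ ⟨
      qint (suc m) * 0#                                           ∎)

    qstarComp-truncate : ∀ g N n → n < N → qstarComp g Fk n ≈Λ ∑PS N (λ k → (g k * (qfact k ⁻¹)) ⊙ Fk k) n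
    qstarComp-truncate g N n n<N α = begin
      qstarComp g Fk n α
        ≡⟨ ≡.trans (ΣΛ-map (λ k → (g k * (qfact k ⁻¹)) ▸ Fk k n) (upTo (suc n)) α) (ΣK-upTo (suc n) term) ⟩
      ∑ (suc n) term
        ≈⟨ ∑-extend (suc n) (N ∸ suc n) term (λ k n<k → trans (*-congˡ (Fk-order k n n<k α)) (zeroʳ _)) ⟩
      ∑ (suc n ℕ.+ (N ∸ suc n)) term
        ≡⟨ ≡.cong (λ m → ∑ m term) (ℕ.m+[n∸m]≡n n<N) ⟩
      ∑ N term
        ∎
      where
      term : ℕ → Carrier
      term k = (g k * (qfact k ⁻¹)) * Fk k n α

    qstarComp-solves : SolvesQExp (Dq F) (qstarComp gEq Fk)
    qstarComp-solves n α = begin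
      I * G (suc n) α
        ≈⟨ *-congˡ (qstarComp-truncate gEq (2 ℕ.+ n) (suc n) ℕ.≤-refl α) ⟩
      I * ∑ (2 ℕ.+ n) (λ k → a k * Fk k (suc n) α)
        ≈⟨ *-distribˡ-∑ (2 ℕ.+ n) I (λ k → a k * Fk k (suc n) α) ⟩
      ∑ (2 ℕ.+ n) (λ k → I * (a k * Fk k (suc n) α))
        ≈⟨ ∑-suc (suc n) (λ k → I * (a k * Fk k (suc n) α))
             (trans (*-congˡ (trans (*-congˡ (proj₁ powers (suc n) α)) (zeroʳ _))) (zeroʳ _)) ⟩
      ∑ (suc n) (λ k → I * (a (suc k) * Fk (suc k) (suc n) α))
        ≈⟨ ∑-cong (suc n) (λ k _ → lower-power k) ⟩
      ∑PS (suc n) (λ k → a k ⊙ (rescale q (Fk k) ⊛ Dq F)) n α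
        ≈⟨ ∑-cong (suc n) (λ k _ → ⊛-scaleˡ (a k) (rescale q (Fk k)) (Dq F) n α) ⟨
      ∑PS (suc n) (λ k → (a k ⊙ rescale q (Fk k)) ⊛ Dq F) n α
        ≈⟨ ⊛-sumˡ (suc n) (λ k → a k ⊙ rescale q (Fk k)) (Dq F) n α ⟨
      (∑PS (suc n) (λ k → a k ⊙ rescale q (Fk k)) ⊛ Dq F) n α
        ≈⟨ ⊛-local (Dq F) n rescaled-truncation α ⟩
      (rescale q G ⊛ Dq F) n α
        ∎
      where
      G : PS
      G = qstarComp gEq Fk

      I : Carrier
      I = qint (suc n)

      a : ℕ → Carrier
      a = Eq-coefficient

      T : ℕ → Carrier
      T j = (rescale q (Fk j) ⊛ Dq F) n α

      lower-power : ∀ k → I * (a (suc k) * Fk (suc k) (suc n) α) ≈ a k * T k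
      lower-power k = begin
        I * (a (suc k) * Fk (suc k) (suc n) α)                   ≈⟨ *-lcomm _ _ _ ⟩
        a (suc k) * (I * Fk (suc k) (suc n) α)                   ≈⟨ *-congˡ (Fk-D k n α) ⟩
        a (suc k) * ((qint (suc k) * (pow q k ⁻¹)) * T k)        ≈⟨ *-assoc _ _ _ ⟨
        (a (suc k) * (qint (suc k) * (pow q k ⁻¹))) * T k        ≈⟨ *-congʳ (Eq-coefficient-step k) ⟩
        a k * T k                                                ∎

      rescaled-truncation : ∀ i → i ≤ n → ∑PS (suc n) (λ k → a k ⊙ rescale q (Fk k)) i ≈Λ rescale q G i
      rescaled-truncation i i≤n β = begin
        ∑ (suc n) (λ k → a k * (pow q i * Fk k i β))
          ≈⟨ ∑-cong (suc n) (λ k _ → *-lcomm (a k) (pow q i) (Fk k i β)) ⟩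
        ∑ (suc n) (λ k → pow q i * (a k * Fk k i β))
          ≈⟨ *-distribˡ-∑ (suc n) (pow q i) (λ k → a k * Fk k i β) ⟨
        pow q i * ∑ (suc n) (λ k → a k * Fk k i β)
          ≈⟨ *-congˡ (qstarComp-truncate gEq (suc n) i (s≤s i≤n) β) ⟨
        pow q i * G i β ∎

    qstarComp-initial : qstarComp gEq Fk 0 ≈Λ 1Λ
    qstarComp-initial α = trans (+-identityʳ _)
      (trans (*-congʳ (⁻¹-inverse 1# (0≉1 ∘ sym))) (trans (*-identityˡ _) (proj₁ powers 0 α)))

module CompleteSolvesQExp {c ℓ : Level} (K : QqField c ℓ)
                          (p : ℕ → Sym.Λ K) (isPowerSums : Sym.IsQPowerSums K p) where
  open QqField K
  open Sym K
  open PowerSeriesAlgebra K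
  open QCalculus K
  open CompleteTimesElementary K
  open QExponentialEquation K using (SolvesQExp)
  open import Algebra.Properties.Ring (CommutativeRing.ring cring) using (-1*x≈-x; -‿involutive; +-inverseˡ-unique)
  open import Algebra.Properties.CommutativeSemigroup *-commutativeSemigroup
    using () renaming (interchange to *-interchange)

  p₊ : PS
  p₊ n = p (suc n)

  Dq-Pq : Dq (Pq p) ≋ p₊
  Dq-Pq n α = begin
    ((pow q (suc n) - 1#) * ((q - 1#) ⁻¹)) * ((I ⁻¹) * p (suc n) α)   ≈⟨ *-congʳ (Dq-factor n) ⟩
    I * ((I ⁻¹) * p (suc n) α)                                        ≈⟨ *-assoc _ _ _ ⟨
    (I * (I ⁻¹)) * p (suc n) α                                        ≈⟨ *-congʳ (⁻¹-inverse I (qint-suc≉0 n)) ⟩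
    1# * p (suc n) α                                                  ≈⟨ *-identityˡ _ ⟩
    p (suc n) α                                                       ∎
    where
    open ≈-Reasoning
    I : Carrier
    I = qint (suc n)

  -1*-1≈1 : (- 1#) * (- 1#) ≈ 1#
  -1*-1≈1 = trans (-1*x≈-x (- 1#)) (-‿involutive 1#)

  pow-[-1]-square : ∀ n → pow (- 1#) n * pow (- 1#) n ≈ 1#
  pow-[-1]-square zero    = *-identityˡ 1#
  pow-[-1]-square (suc n) =
    trans (*-interchange _ _ _ _) (trans (*-cong -1*-1≈1 (pow-[-1]-square n)) (*-identityˡ 1#))

  p₊⊛Ē : (p₊ ⊛ Ē) ≋ ((- 1#) ⊙ D Ē)
  p₊⊛Ē = begin
    p₊ ⊛ Ē                                     ≈⟨ ⊛-congˡ Ē unsign ⟨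
    rescale (- 1#) (signedShift p) ⊛ Ē         ≈⟨ rescale-⊛ (- 1#) (signedShift p) E ⟨
    rescale (- 1#) (signedShift p ⊛ E)         ≈⟨ rescale-cong (- 1#) isPowerSums ⟩
    rescale (- 1#) (Dq E)                      ≈⟨ rescale-cong (- 1#) (Dq≋D E) ⟩
    rescale (- 1#) (D E)                       ≈⟨ sign² ⟨
    (- 1#) ⊙ ((- 1#) ⊙ rescale (- 1#) (D E))   ≈⟨ (λ n α → *-congˡ (D-rescale (- 1#) E n α)) ⟨
    (- 1#) ⊙ D Ē                               ∎
    where
    open ≋-Reasoning
    unsign : rescale (- 1#) (signedShift p) ≋ p₊
    unsign n α = trans (sym (*-assoc _ _ _)) (trans (*-congʳ (pow-[-1]-square n)) (*-identityˡ _))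
    sign² : ∀ {F : PS} → ((- 1#) ⊙ ((- 1#) ⊙ F)) ≋ F
    sign² n α = trans (sym (*-assoc _ _ _)) (trans (*-congʳ -1*-1≈1) (*-identityˡ _))

  DH⊛Ē : (D H ⊛ rescale q Ē) ≋ (H ⊛ (p₊ ⊛ Ē))
  DH⊛Ē n α = begin
    (D H ⊛ rescale q Ē) n α     ≈⟨ +-inverseˡ-unique _ _ D[H⊛Ē]≈0 ⟩
    - (H ⊛ D Ē) n α             ≈⟨ -1*x≈-x _ ⟨
    (- 1#) * (H ⊛ D Ē) n α      ≈⟨ ⊛-scaleʳ (- 1#) H (D Ē) n α ⟨
    (H ⊛ ((- 1#) ⊙ D Ē)) n α    ≈⟨ ⊛-congʳ H p₊⊛Ē n α ⟨
    (H ⊛ (p₊ ⊛ Ē)) n α          ∎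
    where
    open ≈-Reasoning
    D[H⊛Ē]≈0 : (D H ⊛ rescale q Ē) n α + (H ⊛ D Ē) n α ≈ 0#
    D[H⊛Ē]≈0 = trans (sym (D-⊛ H Ē n α)) (trans (D-cong H⊛Ē≋1PS n α) (D-1PS n α))

  H-solves : SolvesQExp (Dq (Pq p)) H
  H-solves = begin
    D H                                  ≈⟨ ⊛-identityʳ (D H) ⟨
    D H ⊛ 1PS                            ≈⟨ ⊛-congʳ (D H) (rescale-1PS q) ⟨
    D H ⊛ rescale q 1PS                  ≈⟨ ⊛-congʳ (D H) (rescale-cong q H⊛Ē≋1PS) ⟨
    D H ⊛ rescale q (H ⊛ Ē)              ≈⟨ ⊛-congʳ (D H) (rescale-⊛ q H Ē) ⟩
    D H ⊛ (rescale q H ⊛ rescale q Ē)    ≈⟨ ⊛-lcomm (D H) (rescale q H) (rescale q Ē) ⟩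
    rescale q H ⊛ (D H ⊛ rescale q Ē)    ≈⟨ ⊛-congʳ (rescale q H) DH⊛Ē ⟩
    rescale q H ⊛ (H ⊛ (p₊ ⊛ Ē))         ≈⟨ ⊛-congʳ (rescale q H) (⊛-lcomm H p₊ Ē) ⟩
    rescale q H ⊛ (p₊ ⊛ (H ⊛ Ē))         ≈⟨ ⊛-congʳ (rescale q H) (⊛-congʳ p₊ H⊛Ē≋1PS) ⟩
    rescale q H ⊛ (p₊ ⊛ 1PS)             ≈⟨ ⊛-congʳ (rescale q H) (⊛-identityʳ p₊) ⟩
    rescale q H ⊛ p₊                     ≈⟨ ⊛-congʳ (rescale q H) Dq-Pq ⟨
    rescale q H ⊛ Dq (Pq p)              ∎
    where open ≋-Reasoning

theorem6p9 : ∀ {c ℓ} (K : QqField c ℓ) → let open Sym K in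
    (p : ℕ → Λ) → IsQPowerSums p →
    (Fk : ℕ → PS) → IsQStarPowers (Pq p) Fk →
    H ≋ qstarComp gEq Fk
theorem6p9 K p isPowerSums Fk powers =
  SolvesQExp-unique (Dq (Pq p)) (λ α → sym (qstarComp-initial α)) H-solves qstarComp-solves
  where
  open QqField K
  open Sym K
  open QExponentialEquation K
  open QStarPowers (Pq p) Fk powers
  open CompleteSolvesQExp K p isPowerSums
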